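{- Let $\mathcal M=(M,\le,{}^\perp)$ be a complete orthomodular lattice, let $L$ be an involutive submonoid of $\mathbf{Lin}(\mathcal M)$ containing all Sasaki projections, and let $\mathscr P(L)=(\mathscr P(L),\bigcup,\odot,{}^*,{\sim},\{\mathrm{id}_M\})$ be the corresponding involutive generalized dynamic algebra. Then $\mathscr P(L)$ is a semi-Foulis dynamic algebra.
   Context: Orthomodular lattice: bounded lattice $(M,\le)$ with ${}^\perp$ satisfying $m\wedge m^\perp=0$, $m\vee m^\perp=1$, $m\le n\Rightarrow n^\perp\le m^\perp$, $m^{\perp\perp}=m$, and $m\le n\Rightarrow n=m\vee(m^\perp\wedge n)$. Sasaki projection: $\pi_m(x)=m\wedge(m^\perp\vee x)$. A map $f:M\to M$ is linear if there is $f^*:M\to M$ with $f(x)\le y^\perp\iff x\le(f^*(y))^\perp$; $\mathbf{Lin}(\mathcal M)$ is the involutive monoid of linear maps under $\circ$, $f\mapsto f^*$, $\mathrm{id}_M$; $\pi_m\in\mathbf{Lin}(\mathcal M)$, $\pi_m^*=\pi_m$. $\mathscr P(L)$: all subsets of $L$, join = union, $A\odot B=\{a\circ b\}$, $A^*=\{a^*\}$, ${\sim}A=\{\pi_{(\bigvee_{a\in A}a(1))^\perp}\}$, unit $\{\mathrm{id}_M\}$; it is an involutive generalized dynamic algebra. For an involutive generalized dynamic algebra $(K,\bigsqcup,\odot,{}^*,{\sim},e)$ one sets $\widetilde K=\{{\sim}k:k\in K\}$, $\bigvee W={\sim}{\sim}\bigsqcup W$ for $W\subseteq\widetilde K$,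 $k\preceq l$ iff $\bigvee\{k,l\}=l$, $w^\perp={\sim}w$; it is a semi-Foulis dynamic algebra if $(\widetilde K,\preceq,{}^\perp)$ is a complete orthomodular lattice. -}

module Defs where

open import Level using (Level; _⊔_; 0ℓ) renaming (suc to lsuc)
open import Data.Product using (Σ; Σ-syntax; ∃; ∃-syntax; _×_; _,_; proj₁; proj₂)
open import Data.Sum using (_⊎_; inj₁; inj₂)
open import Function using (_∘_; id)
open import Relation.Binary.Core using (Rel)
open import Relation.Binary.Structures using (IsPartialOrder)
open import Relation.Binary.PropositionalEquality using (_≡_; refl)

-- Arbitrary joins are over families
-- indexed by a (small) type I : Set (predicative rendering of "subsets").

record IsCompleteOML {c ℓ₁ ℓ₂ : Level} {C : Set c}
         (_≈_ : Rel C ℓ₁) (_≤_ : Rel C ℓ₂) (_⊥ : C → C)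
         : Set (lsuc 0ℓ ⊔ c ⊔ ℓ₁ ⊔ ℓ₂) where
  field
    isPartialOrder : IsPartialOrder _≈_ _≤_
    ⊥-cong   : ∀ {x y} → x ≈ y → (x ⊥) ≈ (y ⊥)
    _∨_ _∧_  : C → C → C
    𝟘 𝟙      : C
    ∨-upperˡ : ∀ x y → x ≤ (x ∨ y)
    ∨-upperʳ : ∀ x y → y ≤ (x ∨ y)
    ∨-least  : ∀ x y z → x ≤ z → y ≤ z → (x ∨ y) ≤ z
    ∧-lowerˡ : ∀ x y → (x ∧ y) ≤ x
    ∧-lowerʳ : ∀ x y → (x ∧ y) ≤ y
    ∧-greatest : ∀ x y z → z ≤ x → z ≤ y → z ≤ (x ∧ y)
    𝟘-least    : ∀ x → 𝟘 ≤ x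
    𝟙-greatest : ∀ x → x ≤ 𝟙
    ⋁        : {I : Set} → (I → C) → C
    ⋁-upper  : {I : Set} (f : I → C) (i : I) → f i ≤ ⋁ f
    ⋁-least  : {I : Set} (f : I → C) (z : C) → (∀ i → f i ≤ z) → ⋁ f ≤ z
    ⊥-meet     : ∀ x → (x ∧ (x ⊥)) ≈ 𝟘
    ⊥-join     : ∀ x → (x ∨ (x ⊥)) ≈ 𝟙
    ⊥-antitone : ∀ {x y} → x ≤ y → (y ⊥) ≤ (x ⊥)
    ⊥-invol    : ∀ x → ((x ⊥) ⊥) ≈ x
    orthomodular : ∀ {x y} → x ≤ y → y ≈ (x ∨ ((x ⊥) ∧ y))

record CompleteOML : Set₁ where
  field
    M      : Set
    _≤_    : M → M → Set
    _⊥     : M → M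
    isCOML : IsCompleteOML _≡_ _≤_ _⊥
  open IsCompleteOML isCOML public

module OnM (𝓜 : CompleteOML) where
  open CompleteOML 𝓜

  IsAdjoint : (M → M) → (M → M) → Set
  IsAdjoint f g = ∀ x y → (f x ≤ (y ⊥) → x ≤ (g y ⊥)) × (x ≤ (g y ⊥) → f x ≤ (y ⊥))

  Linear : (M → M) → Set
  Linear f = ∃[ g ] IsAdjoint f g

  π : M → M → M
  π m x = m ∧ ((m ⊥) ∨ x)

  _≗_ : (M → M) → (M → M) → Set
  f ≗ g = ∀ x → f x ≡ g x

  -- L ⊆ Lin(M) is an involutive submonoid (closed under id, ∘ and *).
  -- `ext` says L is a genuine set of functions (closed under pointwise equality).
  record IsInvolutiveSubmonoid (L : (M → M) → Set) : Set where
    field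
      ext    : ∀ f g → f ≗ g → L f → L g
      linear : ∀ f → L f → Linear f
      id∈    : L id
      ∘∈     : ∀ f g → L f → L g → L (f ∘ g)
      *∈     : ∀ f g → L f → IsAdjoint f g → L g

  ContainsSasaki : ((M → M) → Set) → Set
  ContainsSasaki L = ∀ m → L (π m)

  Subset : Set₁
  Subset = (M → M) → Set

  _≐_ : Subset → Subset → Set
  A ≐ B = (∀ f → A f → ∃[ g ] (B g × f ≗ g))
        × (∀ g → B g → ∃[ f ] (A f × f ≗ g))

  _∪_ : Subset → Subset → Subset
  (A ∪ B) f = A f ⊎ B f

  ~ₛ : Subset → Subset
  ~ₛ A f = f ≡ π ((⋁ {Σ (M → M) A} (λ p → proj₁ p 𝟙)) ⊥)

module KTilde (𝓜 : CompleteOML) (L : (CompleteOML.M 𝓜 → CompleteOML.M 𝓜) → Set)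
              (sas : OnM.ContainsSasaki 𝓜 L) where
  open CompleteOML 𝓜
  open OnM 𝓜

  PL : Set₁
  PL = Σ[ A ∈ Subset ] (∀ f → A f → L f)

  ∪L : PL → PL → PL
  ∪L (A , a) (B , b) = (A ∪ B) , λ { f (inj₁ x) → a f x ; f (inj₂ y) → b f y }

  ~L : PL → PL
  ~L (A , _) = ~ₛ A , λ { f refl → sas _ }

  _≐L_ : PL → PL → Set
  A ≐L B = proj₁ A ≐ proj₁ B

  K̃ : Set₁
  K̃ = Σ[ A ∈ PL ] ∃[ k ] (A ≐L ~L k)

  _≈K_ : K̃ → K̃ → Set
  u ≈K v = proj₁ u ≐L proj₁ v

  -- k ≼ l  iff  ⋁{k,l} = ~~(k ⊔ l) = l
  _≼_ : K̃ → K̃ → Set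
  u ≼ v = ~L (~L (∪L (proj₁ u) (proj₁ v))) ≐L proj₁ v

  _⊥K : K̃ → K̃
  u ⊥K = ~L (proj₁ u) , proj₁ u , ( (λ f p → f , p , λ _ → refl) , (λ g p → g , p , λ _ → refl) )

-- Every element of K̃ has the form ~k = {π_m} with m = (⋁_{a∈k} a(1))⊥, and since
-- π_m(1) = m the singleton {π_m} determines m.  Hence u ↦ m is a bijection from K̃
-- (up to extensional equality) onto M; as ⋁_{a∈A∪B} a(1) = ⋁_{a∈A} a(1) ∨ ⋁_{b∈B} b(1),
-- it turns ≼ into ≤ and ⊥ into ⊥, so the complete orthomodular structure of M
-- transports to (K̃, ≼, ⊥).
module Submission where

open import Defs
open import Level using (Level; _⊔_)
open import Data.Product using (Σ; ∃-syntax; _×_; _,_; proj₁)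
open import Data.Sum using (inj₁; inj₂)
open import Function using (_∘_)
open import Relation.Binary.Core using (Rel)
open import Relation.Binary.Structures using (IsPartialOrder)
open import Relation.Binary.PropositionalEquality
  using (_≡_; refl; sym; trans; cong; cong₂; subst; subst₂; module ≡-Reasoning)

module OrderTheory (𝓜 : CompleteOML) where
  open CompleteOML 𝓜 public
  open IsPartialOrder isPartialOrder public
    using () renaming (refl to ≤-refl; trans to ≤-trans; antisym to ≤-antisym; reflexive to ≤-reflexive)

  ≤⇒∨≡ : ∀ {m n} → m ≤ n → (m ∨ n) ≡ n
  ≤⇒∨≡ {m} {n} m≤n = ≤-antisym (∨-least m n n m≤n ≤-refl) (∨-upperʳ m n)

  ∨≡⇒≤ : ∀ {m n} → (m ∨ n) ≡ n → m ≤ n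
  ∨≡⇒≤ {m} {n} m∨n≡n = subst (m ≤_) m∨n≡n (∨-upperˡ m n)

  ∧-𝟙 : ∀ m → (m ∧ 𝟙) ≡ m
  ∧-𝟙 m = ≤-antisym (∧-lowerˡ m 𝟙) (∧-greatest m 𝟙 m ≤-refl (𝟙-greatest m))

  ∨-𝟙 : ∀ m → (m ∨ 𝟙) ≡ 𝟙
  ∨-𝟙 m = ≤-antisym (𝟙-greatest _) (∨-upperʳ m 𝟙)

record IsOrthoisomorphism (𝓜 : CompleteOML) {k ℓ₁ ℓ₂ : Level} {K : Set k}
         (_≈_ : Rel K ℓ₁) (_≼_ : Rel K ℓ₂) (_⊥' : K → K) : Set (k ⊔ ℓ₁ ⊔ ℓ₂) where
  open CompleteOML 𝓜
  field
    to    : K → M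
    from  : M → K
    to-from : ∀ m → to (from m) ≡ m
    ≈⇒≡   : ∀ {x y} → x ≈ y → to x ≡ to y
    ≡⇒≈   : ∀ {x y} → to x ≡ to y → x ≈ y
    ≼⇒≤   : ∀ {x y} → x ≼ y → to x ≤ to y
    ≤⇒≼   : ∀ {x y} → to x ≤ to y → x ≼ y
    to-⊥  : ∀ x → to (x ⊥') ≡ (to x ⊥)

module Transport (𝓜 : CompleteOML) {k ℓ₁ ℓ₂ : Level} {K : Set k}
         {_≈_ : Rel K ℓ₁} {_≼_ : Rel K ℓ₂} {_⊥' : K → K}
         (iso : IsOrthoisomorphism 𝓜 _≈_ _≼_ _⊥') where
  open OrderTheory 𝓜
  open IsOrthoisomorphism iso

  ≤-to-from : ∀ {a b} → a ≤ b → a ≤ to (from b)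
  ≤-to-from {a} {b} = subst (a ≤_) (sym (to-from b))

  to-from-≤ : ∀ {a b} → a ≤ b → to (from a) ≤ b
  to-from-≤ {a} {b} = subst (_≤ b) (sym (to-from a))

  from-cong : ∀ {m n} → m ≡ n → from m ≈ from n
  from-cong {m} {n} m≡n = ≡⇒≈ (trans (to-from m) (trans m≡n (sym (to-from n))))

  isPartialOrder′ : IsPartialOrder _≈_ _≼_
  isPartialOrder′ = record
    { isPreorder = record
      { isEquivalence = record
        { refl  = ≡⇒≈ refl
        ; sym   = λ x≈y → ≡⇒≈ (sym (≈⇒≡ x≈y))
        ; trans = λ x≈y y≈z → ≡⇒≈ (trans (≈⇒≡ x≈y) (≈⇒≡ y≈z))
        }
      ; reflexive = λ x≈y → ≤⇒≼ (≤-reflexive (≈⇒≡ x≈y))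
      ; trans     = λ x≼y y≼z → ≤⇒≼ (≤-trans (≼⇒≤ x≼y) (≼⇒≤ y≼z))
      }
    ; antisym = λ x≼y y≼x → ≡⇒≈ (≤-antisym (≼⇒≤ x≼y) (≼⇒≤ y≼x))
    }

  orthomodular′ : ∀ {x y} → x ≼ y → y ≈ from (to x ∨ to (from (to (x ⊥') ∧ to y)))
  orthomodular′ {x} {y} x≼y = ≡⇒≈ (begin
    to y                                     ≡⟨ orthomodular (≼⇒≤ x≼y) ⟩
    to x ∨ ((to x ⊥) ∧ to y)                 ≡⟨ cong (λ z → to x ∨ (z ∧ to y)) (sym (to-⊥ x)) ⟩
    to x ∨ (to (x ⊥') ∧ to y)                ≡⟨ cong (to x ∨_) (sym (to-from _)) ⟩
    to x ∨ to (from (to (x ⊥') ∧ to y))      ≡⟨ sym (to-from _) ⟩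
    to (from (to x ∨ to (from (to (x ⊥') ∧ to y)))) ∎)
    where open ≡-Reasoning

  isCompleteOML : IsCompleteOML _≈_ _≼_ _⊥'
  isCompleteOML = record
    { isPartialOrder = isPartialOrder′
    ; ⊥-cong     = λ {x} {y} x≈y → ≡⇒≈ (trans (to-⊥ x) (trans (cong _⊥ (≈⇒≡ x≈y)) (sym (to-⊥ y))))
    ; _∨_        = λ x y → from (to x ∨ to y)
    ; _∧_        = λ x y → from (to x ∧ to y)
    ; 𝟘          = from 𝟘
    ; 𝟙          = from 𝟙
    ; ∨-upperˡ   = λ x y → ≤⇒≼ (≤-to-from (∨-upperˡ _ _))
    ; ∨-upperʳ   = λ x y → ≤⇒≼ (≤-to-from (∨-upperʳ _ _))
    ; ∨-least    = λ x y z x≼z y≼z → ≤⇒≼ (to-from-≤ (∨-least _ _ _ (≼⇒≤ x≼z) (≼⇒≤ y≼z)))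
    ; ∧-lowerˡ   = λ x y → ≤⇒≼ (to-from-≤ (∧-lowerˡ _ _))
    ; ∧-lowerʳ   = λ x y → ≤⇒≼ (to-from-≤ (∧-lowerʳ _ _))
    ; ∧-greatest = λ x y z z≼x z≼y → ≤⇒≼ (≤-to-from (∧-greatest _ _ _ (≼⇒≤ z≼x) (≼⇒≤ z≼y)))
    ; 𝟘-least    = λ x → ≤⇒≼ (to-from-≤ (𝟘-least _))
    ; 𝟙-greatest = λ x → ≤⇒≼ (≤-to-from (𝟙-greatest _))
    ; ⋁          = λ f → from (⋁ (to ∘ f))
    ; ⋁-upper    = λ f i → ≤⇒≼ (≤-to-from (⋁-upper (to ∘ f) i))
    ; ⋁-least    = λ f z bound → ≤⇒≼ (to-from-≤ (⋁-least (to ∘ f) (to z) (≼⇒≤ ∘ bound)))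
    ; ⊥-meet     = λ x → from-cong (trans (cong (to x ∧_) (to-⊥ x)) (⊥-meet (to x)))
    ; ⊥-join     = λ x → from-cong (trans (cong (to x ∨_) (to-⊥ x)) (⊥-join (to x)))
    ; ⊥-antitone = λ {x} {y} x≼y → ≤⇒≼ (subst₂ _≤_ (sym (to-⊥ y)) (sym (to-⊥ x)) (⊥-antitone (≼⇒≤ x≼y)))
    ; ⊥-invol    = λ x → ≡⇒≈ (trans (to-⊥ (x ⊥')) (trans (cong _⊥ (to-⊥ x)) (⊥-invol (to x))))
    ; orthomodular = orthomodular′
    }

module SasakiSubsets (𝓜 : CompleteOML) where
  open OrderTheory 𝓜
  open OnM 𝓜

  ≐-refl : ∀ {A} → A ≐ A
  ≐-refl = (λ f a → f , a , λ _ → refl) , (λ g b → g , b , λ _ → refl)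

  ≐-sym : ∀ {A B} → A ≐ B → B ≐ A
  ≐-sym (A⊆B , B⊆A) = (λ g b → let f , a , f≗g = B⊆A g b in f , a , sym ∘ f≗g)
                    , (λ f a → let g , b , f≗g = A⊆B f a in g , b , sym ∘ f≗g)

  ≐-trans : ∀ {A B C} → A ≐ B → B ≐ C → A ≐ C
  ≐-trans (A⊆B , B⊆A) (B⊆C , C⊆B) =
      (λ f a → let g , b , f≗g = A⊆B f a ; h , c , g≗h = B⊆C g b
               in h , c , λ x → trans (f≗g x) (g≗h x))
    , (λ h c → let g , b , g≗h = C⊆B h c ; f , a , f≗g = B⊆A g b
               in f , a , λ x → trans (f≗g x) (g≗h x))

  ｛π_｝ : M → Subset
  ｛π m ｝ f = f ≡ π m

  π-𝟙 : ∀ m → π m 𝟙 ≡ m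
  π-𝟙 m = trans (cong (m ∧_) (∨-𝟙 (m ⊥))) (∧-𝟙 m)

  ｛π｝-injective : ∀ {m n} → ｛π m ｝ ≐ ｛π n ｝ → m ≡ n
  ｛π｝-injective {m} {n} (⊆ , _) with ⊆ (π m) refl
  ... | _ , refl , πm≗πn = trans (sym (π-𝟙 m)) (trans (πm≗πn 𝟙) (π-𝟙 n))

  ｛π｝-cong : ∀ {m n} → m ≡ n → ｛π m ｝ ≐ ｛π n ｝
  ｛π｝-cong refl = ≐-refl

  -- ⋁_{a∈A} a(1); ~ₛ A is definitionally ｛π ⋁₁ A ⊥ ｝
  ⋁₁ : Subset → M
  ⋁₁ A = ⋁ {Σ (M → M) A} (λ p → proj₁ p 𝟙)

  ⋁₁-mono : ∀ {A B} → (∀ f → A f → ∃[ g ] (B g × f ≗ g)) → ⋁₁ A ≤ ⋁₁ B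
  ⋁₁-mono {A} {B} A⊆B = ⋁-least _ _ λ { (f , a) →
    let g , b , f≗g = A⊆B f a
    in subst (_≤ ⋁₁ B) (sym (f≗g 𝟙)) (⋁-upper (λ p → proj₁ p 𝟙) (g , b)) }

  ⋁₁-cong : ∀ {A B} → A ≐ B → ⋁₁ A ≡ ⋁₁ B
  ⋁₁-cong A≐B@(A⊆B , _) = ≤-antisym (⋁₁-mono A⊆B) (⋁₁-mono (proj₁ (≐-sym A≐B)))

  ⋁₁-∪ : ∀ A B → ⋁₁ (A ∪ B) ≡ (⋁₁ A ∨ ⋁₁ B)
  ⋁₁-∪ A B = ≤-antisym
    (⋁-least _ _ λ { (f , inj₁ a) → ≤-trans (⋁-upper _ (f , a)) (∨-upperˡ _ _)
                   ; (f , inj₂ b) → ≤-trans (⋁-upper _ (f , b)) (∨-upperʳ _ _) })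
    (∨-least _ _ _ (⋁-least _ _ λ { (f , a) → ⋁-upper _ (f , inj₁ a) })
                   (⋁-least _ _ λ { (f , b) → ⋁-upper _ (f , inj₂ b) }))

  ⋁₁-｛π｝ : ∀ m → ⋁₁ ｛π m ｝ ≡ m
  ⋁₁-｛π｝ m = ≤-antisym (⋁-least _ _ λ { (_ , refl) → ≤-reflexive (π-𝟙 m) })
                        (subst (_≤ ⋁₁ ｛π m ｝) (π-𝟙 m) (⋁-upper _ (π m , refl)))

  ⋁₁-｛π⊥｝⊥ : ∀ m → (⋁₁ ｛π m ⊥ ｝ ⊥) ≡ m
  ⋁₁-｛π⊥｝⊥ m = trans (cong _⊥ (⋁₁-｛π｝ (m ⊥))) (⊥-invol m)

  ~ₛ-~ₛ : ∀ A → ~ₛ (~ₛ A) ≐ ｛π ⋁₁ A ｝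
  ~ₛ-~ₛ A = ｛π｝-cong (⋁₁-｛π⊥｝⊥ (⋁₁ A))

  ≐-｛π｝-injective : ∀ {A B m n} → A ≐ ｛π m ｝ → B ≐ ｛π n ｝ → A ≐ B → m ≡ n
  ≐-｛π｝-injective A≐πm B≐πn A≐B =
    ｛π｝-injective (≐-trans (≐-sym A≐πm) (≐-trans A≐B B≐πn))

  ≐-｛π｝-cong : ∀ {A B m n} → A ≐ ｛π m ｝ → B ≐ ｛π n ｝ → m ≡ n → A ≐ B
  ≐-｛π｝-cong A≐πm B≐πn m≡n = ≐-trans A≐πm (≐-trans (｛π｝-cong m≡n) (≐-sym B≐πn))

module K̃≅M (𝓜 : CompleteOML) (L : (CompleteOML.M 𝓜 → CompleteOML.M 𝓜) → Set)
           (sas : OnM.ContainsSasaki 𝓜 L) where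
  open OrderTheory 𝓜
  open OnM 𝓜
  open KTilde 𝓜 L sas
  open SasakiSubsets 𝓜

  carrier : K̃ → Subset
  carrier u = proj₁ (proj₁ u)

  -- the m with u = ｛π m ｝, read off the witness k of u = ~k
  value : K̃ → M
  value (_ , k , _) = ⋁₁ (proj₁ k) ⊥

  carrier-≐ : ∀ u → carrier u ≐ ｛π value u ｝
  carrier-≐ (_ , _ , u≐~k) = u≐~k

  ｛π_｝ₖ : M → K̃
  ｛π m ｝ₖ = (｛π m ｝ , λ { _ refl → sas m })
           , (｛π m ⊥ ｝ , λ { _ refl → sas (m ⊥) })
           , ｛π｝-cong (sym (⋁₁-｛π⊥｝⊥ m))

  ⋁₁-carrier : ∀ u → ⋁₁ (carrier u) ≡ value u
  ⋁₁-carrier u = trans (⋁₁-cong (carrier-≐ u)) (⋁₁-｛π｝ (value u))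

  ≈K⇒≡ : ∀ {u v} → u ≈K v → value u ≡ value v
  ≈K⇒≡ {u} {v} = ≐-｛π｝-injective (carrier-≐ u) (carrier-≐ v)

  ≡⇒≈K : ∀ {u v} → value u ≡ value v → u ≈K v
  ≡⇒≈K {u} {v} = ≐-｛π｝-cong (carrier-≐ u) (carrier-≐ v)

  join-≐ : ∀ u v → proj₁ (~L (~L (∪L (proj₁ u) (proj₁ v)))) ≐ ｛π value u ∨ value v ｝
  join-≐ u v = ≐-trans (~ₛ-~ₛ (carrier u ∪ carrier v))
    (｛π｝-cong (trans (⋁₁-∪ (carrier u) (carrier v)) (cong₂ _∨_ (⋁₁-carrier u) (⋁₁-carrier v))))

  ≼⇒≤ : ∀ {u v} → u ≼ v → value u ≤ value v
  ≼⇒≤ {u} {v} u≼v = ∨≡⇒≤ (≐-｛π｝-injective (join-≐ u v) (carrier-≐ v) u≼v)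

  ≤⇒≼ : ∀ {u v} → value u ≤ value v → u ≼ v
  ≤⇒≼ {u} {v} u≤v = ≐-｛π｝-cong (join-≐ u v) (carrier-≐ v) (≤⇒∨≡ u≤v)

  value-⊥K : ∀ u → value (u ⊥K) ≡ (value u ⊥)
  value-⊥K u = cong _⊥ (⋁₁-carrier u)

  isOrthoisomorphism : IsOrthoisomorphism 𝓜 _≈K_ _≼_ _⊥K
  isOrthoisomorphism = record
    { to = value ; from = ｛π_｝ₖ ; to-from = ⋁₁-｛π⊥｝⊥
    ; ≈⇒≡ = λ {u} {v} → ≈K⇒≡ {u} {v} ; ≡⇒≈ = λ {u} {v} → ≡⇒≈K {u} {v}
    ; ≼⇒≤ = λ {u} {v} → ≼⇒≤ {u} {v} ; ≤⇒≼ = λ {u} {v} → ≤⇒≼ {u} {v}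
    ; to-⊥ = value-⊥K
    }

theorem3p11 : (𝓜 : CompleteOML) (L : (CompleteOML.M 𝓜 → CompleteOML.M 𝓜) → Set)
    → OnM.IsInvolutiveSubmonoid 𝓜 L
    → (sas : OnM.ContainsSasaki 𝓜 L)
    → IsCompleteOML (KTilde._≈K_ 𝓜 L sas) (KTilde._≼_ 𝓜 L sas) (KTilde._⊥K 𝓜 L sas)
theorem3p11 𝓜 L _ sas = Transport.isCompleteOML 𝓜 (K̃≅M.isOrthoisomorphism 𝓜 L sas)
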